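{- Let $n\ge 3$, let $F\subseteq E(BH_n)$ with $|F|\le 4n-5$, let $j\in\{0,1,\dots,n-1\}$, and let $BH^{j,i}_{n-1}$ be one of the four components of $BH_n-\partial D_j$. Then for every vertex $u$ of $BH^{j,i}_{n-1}$ there exist vertices $v,w$ such that $(u,v)\in E(BH^{j,i}_{n-1})$ and $(v,w)$ is a $j$-dimension edge with $(v,w)\notin F$. Moreover, if $u$ has exactly one neighbour in $BH^{j,i}_{n-1}-F$ (i.e. $u$ is $1$-rescuable in $BH_n-\partial D_j$), then $v$ can be chosen so that $(u,v)\in F$.
   Context: The $n$-dimensional balanced hypercube $BH_n$ has vertex set $\{0,1,2,3\}^n$, vertices written $(a_0,a_1,\dots,a_{n-1})$; coordinate arithmetic is modulo $4$. A vertex $(a_0,\dots,a_{n-1})$ is adjacent exactly to $(a_0\pm 1,a_1,\dots,a_{n-1})$ and, for each $1\le i\le n-1$, to $(a_0\pm1,a_1,\dots,a_{i-1},a_i+(-1)^{a_0},a_{i+1},\dots,a_{n-1})$. An edge $(u,v)$ is a $0$-dimension edge if $u,v$ differ only in $a_0$, and an $i$-dimension edge ($1\le i\le n-1$) if they differ in $a_0$ and in $a_i$; $\partial D_d$ is the set of $d$-dimension edges. Each vertex is incident with exactly two $d$-dimension edges for each $d$. For $1\le j\le n-1$ and $i\in\{0,1,2,3\}$, $BH^{j,i}_{n-1}$ is the subgraph induced by the vertices with $a_j=i$; these are the four components of $BH_n-\partial D_j$, each isomorphic to $BH_{n-1}$. For $j=0$, $BH^{0,0}_{n-1},\dots,BH^{0,3}_{n-1}$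 denote the four components of $BH_n-\partial D_0$ (each isomorphic to $BH_{n-1}$). A vertex $u$ is $k$-rescuable in a subgraph $G$ if $|N_{G-F}(u)|=k$. -}

module Defs where

open import Data.Nat using (ℕ; suc)
open import Data.Fin using (Fin; zero; suc)
open import Data.Vec using (Vec; _∷_; lookup; _[_]≔_)
open import Data.Bool using (Bool; true; false)
open import Data.Product using (Σ; _×_; ∃; ∃-syntax)
open import Data.Sum using (_⊎_)
open import Data.List using (List)
open import Data.List.Membership.Propositional using (_∈_)
open import Relation.Nullary using (¬_)
open import Relation.Binary.PropositionalEquality using (_≡_)
open import Data.Product using (_,_)

inc4 : Fin 4 → Fin 4
inc4 zero = suc zero
inc4 (suc zero) = suc (suc zero)
inc4 (suc (suc zero)) = suc (suc (suc zero))
inc4 (suc (suc (suc zero))) = zero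

dec4 : Fin 4 → Fin 4
dec4 zero = suc (suc (suc zero))
dec4 (suc zero) = zero
dec4 (suc (suc zero)) = suc zero
dec4 (suc (suc (suc zero))) = suc (suc zero)

pm4 : Bool → Fin 4 → Fin 4
pm4 true  a = inc4 a
pm4 false a = dec4 a

-- x + (-1)^a  (mod 4)
twist : Fin 4 → Fin 4 → Fin 4
twist zero x = inc4 x
twist (suc zero) x = dec4 x
twist (suc (suc zero)) x = inc4 x
twist (suc (suc (suc zero))) x = dec4 x

Vertex : ℕ → Set
Vertex n = Vec (Fin 4) n

-- DimEdge d u v : v is joined to u by a d-dimension edge.
--   d = 0     : v = (a_0 ± 1, a_1, ..., a_{n-1})
--   d = i ≥ 1 : v = (a_0 ± 1, ..., a_i + (-1)^{a_0}, ...)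
-- (the coordinate a_{suc i} of the vertex is entry i of the tail)
data DimEdge : {n : ℕ} → Fin n → Vertex n → Vertex n → Set where
  dim0 : ∀ {m} (s : Bool) (a : Fin 4) (as : Vertex m) →
         DimEdge zero (a ∷ as) (pm4 s a ∷ as)
  dimi : ∀ {m} (i : Fin m) (s : Bool) (a : Fin 4) (as : Vertex m) →
         DimEdge (suc i) (a ∷ as) (pm4 s a ∷ (as [ i ]≔ twist a (lookup as i)))

Edge : {n : ℕ} → Vertex n → Vertex n → Set
Edge {n} u v = ∃[ d ] DimEdge {n} d u v

InF : {n : ℕ} → List (Vertex n × Vertex n) → Vertex n → Vertex n → Set
InF F u v = ((u , v) ∈ F) ⊎ ((v , u) ∈ F)

-- Reach j c x : x lies in the same connected component of BH_n - ∂D_j as c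
data Reach {n : ℕ} (j : Fin n) (c : Vertex n) : Vertex n → Set where
  here : Reach j c c
  step : ∀ {x y} → Reach j c x → Edge x y → ¬ DimEdge j x y → Reach j c y

CompEdge : {n : ℕ} → Fin n → Vertex n → Vertex n → Vertex n → Set
CompEdge j c x y = Edge x y × ¬ DimEdge j x y × Reach j c x × Reach j c y

NbrGF : {n : ℕ} → List (Vertex n × Vertex n) → Fin n → Vertex n → Vertex n → Vertex n → Set
NbrGF F j c u v = CompEdge j c u v × ¬ InF F u v

OneRescuable : {n : ℕ} → List (Vertex n × Vertex n) → Fin n → Vertex n → Vertex n → Set
OneRescuable F j c u = Σ _ λ v → NbrGF F j c u v × (∀ v' → NbrGF F j c u v' → v' ≡ v)

-- Write n = m + 1. Besides its two j-dimension edges, u has 2m neighbours v,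
-- each of which has two j-dimension edges (v , w). Every edge changes the
-- parity of the first coordinate, so these 2m spokes (u , v) and 4m dangling
-- edges (v , w) are pairwise distinct. A fault set with |F| ≤ 4n - 5 < 4m
-- edges therefore misses some dangling edge. If moreover u keeps a single
-- fault-free spoke (u , v*), and no faulty spoke leads to a fault-free
-- dangling edge, then all 6m spokes and dangling edges lie in F together with
-- (u , v*) and the two j-dimension edges at v*, so 6m ≤ |F| + 3 ≤ 4m + 2,
-- which is impossible for m ≥ 2.
module Submission where

open import Defs
open import Data.Nat using (ℕ; zero; suc; _≤_; _<_; _*_; _+_; _∸_; s≤s; z≤n; _≤?_)
open import Data.Nat.Properties
  using (≤-<-trans; <⇒≤; <⇒≱; ≰⇒>; m+n∸m≡n; n<1+n; m<m+n; +-monoʳ-≤; module ≤-Reasoning)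
open import Data.Nat.Tactic.RingSolver using (solve-∀)
open import Data.Fin using (Fin; zero; suc; punchIn)
open import Data.Fin.Properties
  using (_≟_; any?; pigeonhole; punchIn-injective; punchInᵢ≢i; 2↔Bool; *↔×; +↔⊎; <⇒≢)
open import Data.Vec using (_∷_; head; lookup; _[_]≔_)
open import Data.Vec.Properties
  using (∷-injectiveˡ; ∷-injectiveʳ; lookup∘update; lookup∘update′; []≔-idempotent; []≔-lookup)
import Data.Vec.Properties as Vec
open import Data.Bool using (Bool; true; false; not)
open import Data.Bool.Properties using (not-¬; not-involutive)
open import Data.List using (List; length; _∷_)
import Data.List as List
open import Data.List.Relation.Unary.All using (All)
open import Data.List.Relation.Unary.Any using (here; there; index)
import Data.List.Relation.Unary.Any as Any
open import Data.List.Relation.Unary.Any.Properties using (lookup-index)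
open import Data.Product using (_×_; _,_; proj₁; proj₂; ∃; ∃-syntax; swap; uncurry)
import Data.Product.Properties as Product
open import Data.Product.Function.NonDependent.Propositional using (_×-↔_)
open import Data.Sum using (_⊎_; inj₁; inj₂; [_,_]; map)
open import Data.Sum.Function.Propositional using (_⊎-↔_)
open import Data.Empty using (⊥-elim)
open import Function using (_∘_; _↔_; Inverse)
open import Function.Construct.Composition using (_↔-∘_)
open import Function.Construct.Identity using (↔-id)
open import Function.Properties.Inverse using (↔⇒↣)
open import Function.Bundles using (Injection)
open import Relation.Nullary using (¬_; Dec; yes; no; ¬?; contradiction)
open import Relation.Nullary.Decidable using (_⊎-dec_; _×-dec_; map′; decidable-stable)
open import Relation.Unary using (Decidable)
open import Relation.Binary.PropositionalEquality hiding ([_])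

even4 : Fin 4 → Bool
even4 zero = true
even4 (suc zero) = false
even4 (suc (suc zero)) = true
even4 (suc (suc (suc zero))) = false

even4-pm4 : ∀ s a → even4 (pm4 s a) ≡ not (even4 a)
even4-pm4 true zero = refl
even4-pm4 true (suc zero) = refl
even4-pm4 true (suc (suc zero)) = refl
even4-pm4 true (suc (suc (suc zero))) = refl
even4-pm4 false zero = refl
even4-pm4 false (suc zero) = refl
even4-pm4 false (suc (suc zero)) = refl
even4-pm4 false (suc (suc (suc zero))) = refl

twist≡pm4 : ∀ a x → twist a x ≡ pm4 (even4 a) x
twist≡pm4 zero x = refl
twist≡pm4 (suc zero) x = refl
twist≡pm4 (suc (suc zero)) x = refl
twist≡pm4 (suc (suc (suc zero))) x = refl

pm4-≢ : ∀ s a → pm4 s a ≢ a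
pm4-≢ s a eq = not-¬ (cong even4 eq) (even4-pm4 s a)

twist-≢ : ∀ a x → twist a x ≢ x
twist-≢ a x eq = pm4-≢ (even4 a) x (trans (sym (twist≡pm4 a x)) eq)

pm4-injective : ∀ s s' a → pm4 s a ≡ pm4 s' a → s ≡ s'
pm4-injective true true _ _ = refl
pm4-injective false false _ _ = refl
pm4-injective true false zero ()
pm4-injective true false (suc zero) ()
pm4-injective true false (suc (suc zero)) ()
pm4-injective true false (suc (suc (suc zero))) ()
pm4-injective false true zero ()
pm4-injective false true (suc zero) ()
pm4-injective false true (suc (suc zero)) ()
pm4-injective false true (suc (suc (suc zero))) ()

pm4-involutive : ∀ s a → pm4 (not s) (pm4 s a) ≡ a
pm4-involutive true zero = refl
pm4-involutive true (suc zero) = refl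
pm4-involutive true (suc (suc zero)) = refl
pm4-involutive true (suc (suc (suc zero))) = refl
pm4-involutive false zero = refl
pm4-involutive false (suc zero) = refl
pm4-involutive false (suc (suc zero)) = refl
pm4-involutive false (suc (suc (suc zero))) = refl

twist-involutive : ∀ s a x → twist (pm4 s a) (twist a x) ≡ x
twist-involutive s a x = begin
  twist (pm4 s a) (twist a x)               ≡⟨ twist≡pm4 (pm4 s a) _ ⟩
  pm4 (even4 (pm4 s a)) (twist a x)         ≡⟨ cong₂ pm4 (even4-pm4 s a) (twist≡pm4 a x) ⟩
  pm4 (not (even4 a)) (pm4 (even4 a) x)     ≡⟨ pm4-involutive (even4 a) x ⟩
  x                                         ∎
  where open ≡-Reasoning

neighbour : ∀ {m} → Fin (suc m) → Bool → Vertex (suc m) → Vertex (suc m)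
neighbour zero s (a ∷ as) = pm4 s a ∷ as
neighbour (suc i) s (a ∷ as) = pm4 s a ∷ (as [ i ]≔ twist a (lookup as i))

neighbour-dimEdge : ∀ {m} d s (x : Vertex (suc m)) → DimEdge d x (neighbour d s x)
neighbour-dimEdge zero s (a ∷ as) = dim0 s a as
neighbour-dimEdge (suc i) s (a ∷ as) = dimi i s a as

dimEdge⇒neighbour : ∀ {m} {d} {x y : Vertex (suc m)} → DimEdge d x y → ∃[ s ] y ≡ neighbour d s x
dimEdge⇒neighbour (dim0 s a as) = s , refl
dimEdge⇒neighbour (dimi i s a as) = s , refl

parity : ∀ {m} → Vertex (suc m) → Bool
parity x = even4 (head x)

parity-neighbour : ∀ {m} d s (x : Vertex (suc m)) → parity (neighbour d s x) ≡ not (parity x)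
parity-neighbour zero s (a ∷ as) = even4-pm4 s a
parity-neighbour (suc i) s (a ∷ as) = even4-pm4 s a

parity-≢ : ∀ {m} {x y : Vertex (suc m)} → parity x ≡ not (parity y) → x ≢ y
parity-≢ p eq = not-¬ (cong parity eq) p

update-twist-≢ : ∀ {m} a as (i : Fin m) → as [ i ]≔ twist a (lookup as i) ≢ as
update-twist-≢ a as i eq =
  twist-≢ a (lookup as i) (trans (sym (lookup∘update i as _)) (cong (λ z → lookup z i) eq))

neighbour-injective : ∀ {m} d d' s s' (x : Vertex (suc m)) →
                      neighbour d s x ≡ neighbour d' s' x → d ≡ d' × s ≡ s'
neighbour-injective zero zero s s' (a ∷ as) eq = refl , pm4-injective s s' a (∷-injectiveˡ eq)
neighbour-injective zero (suc i') s s' (a ∷ as) eq =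
  ⊥-elim (update-twist-≢ a as i' (sym (∷-injectiveʳ eq)))
neighbour-injective (suc i) zero s s' (a ∷ as) eq =
  ⊥-elim (update-twist-≢ a as i (∷-injectiveʳ eq))
neighbour-injective (suc i) (suc i') s s' (a ∷ as) eq with i ≟ i'
... | yes refl = refl , pm4-injective s s' a (∷-injectiveˡ eq)
... | no i≢i' = ⊥-elim (twist-≢ a (lookup as i) (begin
  twist a (lookup as i)                         ≡⟨ lookup∘update i as _ ⟨
  lookup (as [ i ]≔ twist a (lookup as i)) i    ≡⟨ cong (λ z → lookup z i) (∷-injectiveʳ eq) ⟩
  lookup (as [ i' ]≔ twist a (lookup as i')) i  ≡⟨ lookup∘update′ i≢i' as _ ⟩
  lookup as i                                   ∎))
  where open ≡-Reasoning

neighbour-involutive : ∀ {m} d s (x : Vertex (suc m)) → neighbour d (not s) (neighbour d s x) ≡ x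
neighbour-involutive zero s (a ∷ as) = cong (_∷ as) (pm4-involutive s a)
neighbour-involutive (suc i) s (a ∷ as) = cong₂ _∷_ (pm4-involutive s a) (begin
  (as [ i ]≔ t) [ i ]≔ twist (pm4 s a) (lookup (as [ i ]≔ t) i)
    ≡⟨ cong (λ z → (as [ i ]≔ t) [ i ]≔ twist (pm4 s a) z) (lookup∘update i as t) ⟩
  (as [ i ]≔ t) [ i ]≔ twist (pm4 s a) t
    ≡⟨ cong ((as [ i ]≔ t) [ i ]≔_) (twist-involutive s a (lookup as i)) ⟩
  (as [ i ]≔ t) [ i ]≔ lookup as i
    ≡⟨ []≔-idempotent as i ⟩
  as [ i ]≔ lookup as i
    ≡⟨ []≔-lookup as i ⟩
  as ∎)
  where
  open ≡-Reasoning
  t = twist a (lookup as i)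

SameEdge : {A : Set} → A × A → A × A → Set
SameEdge e e' = e ≡ e' ⊎ e ≡ swap e'

sameEdge-sym : {A : Set} {e e' : A × A} → SameEdge e e' → SameEdge e' e
sameEdge-sym (inj₁ p) = inj₁ (sym p)
sameEdge-sym (inj₂ p) = inj₂ (cong swap (sym p))

sameEdge-trans : {A : Set} {e e' e'' : A × A} → SameEdge e e' → SameEdge e' e'' → SameEdge e e''
sameEdge-trans (inj₁ p) (inj₁ q) = inj₁ (trans p q)
sameEdge-trans (inj₁ p) (inj₂ q) = inj₂ (trans p q)
sameEdge-trans (inj₂ p) (inj₁ q) = inj₂ (trans p (cong swap q))
sameEdge-trans (inj₂ p) (inj₂ q) = inj₁ (trans p (cong swap q))

InF? : ∀ {n} (F : List (Vertex n × Vertex n)) x y → Dec (InF F x y)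
InF? F x y = Any.any? ((x , y) ≟ₑ_) F ⊎-dec Any.any? ((y , x) ≟ₑ_) F
  where _≟ₑ_ = Product.≡-dec (Vec.≡-dec _≟_) (Vec.≡-dec _≟_)

position : ∀ {n} (F : List (Vertex n × Vertex n)) {x y} → InF F x y → Fin (length F)
position F (inj₁ p) = index p
position F (inj₂ p) = index p

position-sameEdge : ∀ {n} (F : List (Vertex n × Vertex n)) {x y} (p : InF F x y) →
                    SameEdge (x , y) (List.lookup F (position F p))
position-sameEdge F (inj₁ p) = inj₁ (lookup-index p)
position-sameEdge F (inj₂ p) = inj₂ (cong swap (lookup-index p))

distinctEdges≤length : ∀ {n N} {I : Set} (enum : Fin N ↔ I)
  (F : List (Vertex n × Vertex n)) (f : I → Vertex n × Vertex n) →
  (∀ x → uncurry (InF F) (f x)) → (∀ x y → SameEdge (f x) (f y) → x ≡ y) →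
  N ≤ length F
distinctEdges≤length {N = N} enum F f f∈F f-injective with N ≤? length F
... | yes N≤|F| = N≤|F|
... | no N≰|F|
  with i , i' , i<i' , samePosition ← pigeonhole (≰⇒> N≰|F|) (position F ∘ f∈F ∘ Inverse.to enum)
  = contradiction (Injection.injective (↔⇒↣ enum) (f-injective _ _ sameEdge)) (<⇒≢ i<i')
  where
  x = Inverse.to enum i
  x' = Inverse.to enum i'
  sameEdge : SameEdge (f x) (f x')
  sameEdge = sameEdge-trans (position-sameEdge F (f∈F x))
    (sameEdge-sym (subst (SameEdge (f x') ∘ List.lookup F) (sym samePosition)
                         (position-sameEdge F (f∈F x'))))

any?-↔ : ∀ {N} {I : Set} {P : I → Set} → Fin N ↔ I → Decidable P → Dec (∃ P)
any?-↔ {P = P} enum P? =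
  map′ (λ (i , p) → to i , p) (λ (x , p) → from x , subst P (sym (strictlyInverseˡ x)) p)
       (any? (P? ∘ to))
  where open Inverse enum using (to; from; strictlyInverseˡ)

module Neighbourhood {m : ℕ} (j : Fin (suc m)) (u : Vertex (suc m)) where

  Spoke : Set
  Spoke = Fin m × Bool

  Dangling : Set
  Dangling = Spoke × Bool

  -- punchIn j ranges over the dimensions other than j.
  nbr : Spoke → Vertex (suc m)
  nbr (k , s) = neighbour (punchIn j k) s u

  far : Dangling → Vertex (suc m)
  far (x , a) = neighbour j a (nbr x)

  spoke : Spoke → Vertex (suc m) × Vertex (suc m)
  spoke x = u , nbr x

  dangling : Dangling → Vertex (suc m) × Vertex (suc m)
  dangling x = nbr (proj₁ x) , far x

  edge : Spoke ⊎ Dangling → Vertex (suc m) × Vertex (suc m)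
  edge = [ spoke , dangling ]

  spokes↔ : Fin (m * 2) ↔ Spoke
  spokes↔ = (↔-id (Fin m) ×-↔ 2↔Bool) ↔-∘ *↔×

  danglings↔ : Fin (m * 2 * 2) ↔ Dangling
  danglings↔ = (spokes↔ ×-↔ 2↔Bool) ↔-∘ *↔×

  edges↔ : Fin (m * 2 + m * 2 * 2) ↔ (Spoke ⊎ Dangling)
  edges↔ = (spokes↔ ⊎-↔ danglings↔) ↔-∘ +↔⊎

  nbr-injective : ∀ {x y} → nbr x ≡ nbr y → x ≡ y
  nbr-injective {k , s} {k' , s'} eq
    with d≡d' , refl ← neighbour-injective (punchIn j k) (punchIn j k') s s' u eq
    = cong (_, s) (punchIn-injective j k k' d≡d')

  u≢nbr : ∀ {x} → u ≢ nbr x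
  u≢nbr {k , s} = parity-≢ (parity-neighbour (punchIn j k) s u) ∘ sym

  nbr≢far : ∀ {x y} → nbr x ≢ far y
  nbr≢far {k , s} {(k' , s') , a} = parity-≢ (begin
    parity (nbr (k , s))                      ≡⟨ parity-neighbour (punchIn j k) s u ⟩
    not (parity u)                            ≡⟨ cong not (not-involutive (parity u)) ⟨
    not (not (not (parity u)))                ≡⟨ cong (not ∘ not) (parity-neighbour (punchIn j k') s' u) ⟨
    not (not (parity (nbr (k' , s'))))        ≡⟨ cong not (parity-neighbour j a (nbr (k' , s'))) ⟨
    not (parity (far ((k' , s') , a)))        ∎)
    where open ≡-Reasoning

  -- u is itself a neighbour of nbr x, but along dimension punchIn j k ≠ j.
  u≢far : ∀ {y} → u ≢ far y
  u≢far {(k , s) , a} eq = punchInᵢ≢i j k (sym (proj₁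
    (neighbour-injective j (punchIn j k) a (not s) (nbr (k , s))
      (trans (sym eq) (sym (neighbour-involutive (punchIn j k) s u))))))

  edge-injective : ∀ x y → SameEdge (edge x) (edge y) → x ≡ y
  edge-injective (inj₁ x) (inj₁ y) (inj₁ eq) = cong inj₁ (nbr-injective (cong proj₂ eq))
  edge-injective (inj₁ x) (inj₁ y) (inj₂ eq) = ⊥-elim (u≢nbr (cong proj₁ eq))
  edge-injective (inj₁ x) (inj₂ y) (inj₁ eq) = ⊥-elim (u≢nbr (cong proj₁ eq))
  edge-injective (inj₁ x) (inj₂ y) (inj₂ eq) = ⊥-elim (u≢far (cong proj₁ eq))
  edge-injective (inj₂ x) (inj₁ y) (inj₁ eq) = ⊥-elim (u≢nbr (sym (cong proj₁ eq)))
  edge-injective (inj₂ x) (inj₁ y) (inj₂ eq) = ⊥-elim (u≢far (sym (cong proj₂ eq)))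
  edge-injective (inj₂ (x , a)) (inj₂ (y , b)) (inj₁ eq)
    with refl ← nbr-injective (cong proj₁ eq)
    = cong (inj₂ ∘ (x ,_)) (proj₂ (neighbour-injective j j a b (nbr x) (cong proj₂ eq)))
  edge-injective (inj₂ x) (inj₂ y) (inj₂ eq) = ⊥-elim (nbr≢far (cong proj₁ eq))

  dangling-injective : ∀ x y → SameEdge (dangling x) (dangling y) → x ≡ y
  dangling-injective x y eq with refl ← edge-injective (inj₂ x) (inj₂ y) eq = refl

  nbr-¬dimEdge : ∀ x → ¬ DimEdge j u (nbr x)
  nbr-¬dimEdge (k , s) de with s' , eq ← dimEdge⇒neighbour de =
    punchInᵢ≢i j k (proj₁ (neighbour-injective (punchIn j k) j s s' u eq))

  nbr-compEdge : ∀ {c} → Reach j c u → ∀ x → CompEdge j c u (nbr x)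
  nbr-compEdge r (k , s) =
    e , nbr-¬dimEdge (k , s) , r , step r e (nbr-¬dimEdge (k , s))
    where e = punchIn j k , neighbour-dimEdge (punchIn j k) s u

  intact-dangling : (F : List (Vertex (suc m) × Vertex (suc m))) → length F < m * 2 * 2 →
                    ∃[ x ] ¬ InF F (nbr (proj₁ x)) (far x)
  intact-dangling F short with any?-↔ danglings↔ (λ x → ¬? (InF? F (nbr (proj₁ x)) (far x)))
  ... | yes found = found
  ... | no none = contradiction
    (distinctEdges≤length danglings↔ F dangling
      (λ x → decidable-stable (InF? F _ _) (none ∘ (x ,_))) dangling-injective)
    (<⇒≱ short)

  intact-dangling-at-faulty-spoke :
    (F : List (Vertex (suc m) × Vertex (suc m))) (v : Vertex (suc m)) →
    3 + length F < m * 2 + m * 2 * 2 → (∀ x → ¬ InF F u (nbr x) → nbr x ≡ v) →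
    ∃[ x ] InF F u (nbr (proj₁ x)) × ¬ InF F (nbr (proj₁ x)) (far x)
  intact-dangling-at-faulty-spoke F v short onlyV
    with any?-↔ danglings↔ (λ x → InF? F u (nbr (proj₁ x)) ×-dec ¬? (InF? F (nbr (proj₁ x)) (far x)))
  ... | yes found = found
  ... | no none = contradiction
    (distinctEdges≤length edges↔ F' edge covered edge-injective) (<⇒≱ short)
    where
    F' = (u , v) ∷ (v , neighbour j true v) ∷ (v , neighbour j false v) ∷ F

    weaken : ∀ {x y} → InF F x y → InF F' x y
    weaken = map (there ∘ there ∘ there) (there ∘ there ∘ there)

    jEdge∈F' : ∀ a → InF F' v (neighbour j a v)
    jEdge∈F' true = inj₁ (there (here refl))
    jEdge∈F' false = inj₁ (there (there (here refl)))

    covered : ∀ e → uncurry (InF F') (edge e)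
    covered (inj₁ x) with InF? F u (nbr x)
    ... | yes spoke∈F = weaken spoke∈F
    ... | no spoke∉F = subst (InF F' u) (sym (onlyV x spoke∉F)) (inj₁ (here refl))
    covered (inj₂ (x , a)) with InF? F u (nbr x)
    ... | yes spoke∈F = weaken (decidable-stable (InF? F _ _) (λ ∉F → none ((x , a) , spoke∈F , ∉F)))
    ... | no spoke∉F =
      subst (λ z → InF F' z (neighbour j a z)) (sym (onlyV x spoke∉F)) (jEdge∈F' a)

dangling-bound : ∀ {m} → 1 ≤ m → 4 * suc m ∸ 5 < m * 2 * 2
dangling-bound {suc k} (s≤s z≤n) = begin-strict
  4 * (2 + k) ∸ 5        ≡⟨ cong (_∸ 5) (lhs k) ⟩
  5 + (3 + 4 * k) ∸ 5    ≡⟨ m+n∸m≡n 5 (3 + 4 * k) ⟩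
  3 + 4 * k              <⟨ n<1+n _ ⟩
  4 + 4 * k              ≡⟨ rhs k ⟩
  (1 + k) * 2 * 2        ∎
  where
  open ≤-Reasoning
  lhs : ∀ k → 4 * (2 + k) ≡ 5 + (3 + 4 * k)
  lhs = solve-∀
  rhs : ∀ k → 4 + 4 * k ≡ (1 + k) * 2 * 2
  rhs = solve-∀

rescue-bound : ∀ {m} → 2 ≤ m → 3 + (4 * suc m ∸ 5) < m * 2 + m * 2 * 2
rescue-bound {suc (suc k)} (s≤s (s≤s z≤n)) = begin-strict
  3 + (4 * (3 + k) ∸ 5)       ≡⟨ cong (λ z → 3 + (z ∸ 5)) (lhs k) ⟩
  3 + (5 + (7 + 4 * k) ∸ 5)   ≡⟨ cong (3 +_) (m+n∸m≡n 5 (7 + 4 * k)) ⟩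
  10 + 4 * k                  <⟨ m<m+n (10 + 4 * k) (s≤s z≤n) ⟩
  10 + 4 * k + (2 + 2 * k)    ≡⟨ rhs k ⟩
  (2 + k) * 2 + (2 + k) * 2 * 2 ∎
  where
  open ≤-Reasoning
  lhs : ∀ k → 4 * (3 + k) ≡ 5 + (7 + 4 * k)
  lhs = solve-∀
  rhs : ∀ k → 10 + 4 * k + (2 + 2 * k) ≡ (2 + k) * 2 + (2 + k) * 2 * 2
  rhs = solve-∀

lemma7 : (n : ℕ) → 3 ≤ n →
         (F : List (Vertex n × Vertex n)) →
         All (λ e → Edge (proj₁ e) (proj₂ e)) F →
         length F ≤ 4 * n ∸ 5 →
         (j : Fin n) → (c u : Vertex n) → Reach j c u →
         (∃[ v ] ∃[ w ] (CompEdge j c u v × DimEdge j v w × ¬ InF F v w))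
         × (OneRescuable F j c u →
            ∃[ v ] ∃[ w ] (CompEdge j c u v × InF F u v × DimEdge j v w × ¬ InF F v w))
lemma7 (suc m) (s≤s 2≤m) F _ |F|≤ j c u u∈G = intact , rescue
  where
  open Neighbourhood j u

  intact : ∃[ v ] ∃[ w ] (CompEdge j c u v × DimEdge j v w × ¬ InF F v w)
  intact with (x , a) , ∉F ← intact-dangling F (≤-<-trans |F|≤ (dangling-bound (<⇒≤ 2≤m)))
    = nbr x , far (x , a) , nbr-compEdge u∈G x , neighbour-dimEdge j a (nbr x) , ∉F

  rescue : OneRescuable F j c u →
           ∃[ v ] ∃[ w ] (CompEdge j c u v × InF F u v × DimEdge j v w × ¬ InF F v w)
  rescue (v , _ , unique)
    with (x , a) , ∈F , ∉F ← intact-dangling-at-faulty-spoke F v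
           (≤-<-trans (+-monoʳ-≤ 3 |F|≤) (rescue-bound 2≤m))
           (λ x ∉F → unique (nbr x) (nbr-compEdge u∈G x , ∉F))
    = nbr x , far (x , a) , nbr-compEdge u∈G x , ∈F , neighbour-dimEdge j a (nbr x) , ∉F
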